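{- Let $\pi\colon\mathbb{P}\to\mathbb{Q}$ be a projection of forcing notions, let $\kappa$ be a regular cardinal and let $p\in\mathbb{P}$. If there is a $\kappa$-complete ultrafilter on $\mathbb{P}$ extending $D_p(\mathbb{P})$, then there is a $\kappa$-complete ultrafilter on $\mathbb{Q}$ extending $D_{\pi(p)}(\mathbb{Q})$.
   Context: Forcing convention: $p\le q$ means $q$ is stronger. A map $\pi\colon\mathbb{P}\to\mathbb{Q}$ is a projection if it is order preserving, its image is dense in $\mathbb{Q}$, and for all $p\in\mathbb{P}$ and $q\ge\pi(p)$ there is $p'\ge p$ with $\pi(p')\ge q$. For a forcing $\mathbb{R}$ and $r\in\mathbb{R}$, $D_r(\mathbb{R})$ is the filter on $\mathbb{R}$ generated by all dense open subsets of $\mathbb{R}$ together with $\{s\in\mathbb{R}\mid s\ge r\}$. -}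

module Defs where

open import Level using (0ℓ)
open import Data.Nat using (ℕ)
open import Data.Product using (Σ; Σ-syntax; ∃; ∃-syntax; _×_; _,_)
open import Data.Sum using (_⊎_)
open import Data.Empty using (⊥)
open import Data.Unit using (⊤)
open import Relation.Nullary using (¬_)
open import Relation.Unary using (Pred; _⊆_; _∩_; ∁; ⋂; _∈_)
open import Relation.Binary.PropositionalEquality using (_≡_)
open import Function.Definitions using (Injective)

-- Forcing notions: preorders, p ≤ q meaning q is stronger.

record Forcing : Set₁ where
  field
    Carrier : Set
    _≤_     : Carrier → Carrier → Set
    ≤-refl  : ∀ {p} → p ≤ p
    ≤-trans : ∀ {p q r} → p ≤ q → q ≤ r → p ≤ r
open Forcing public

Subset : Forcing → Set₁
Subset ℝ = Pred (Carrier ℝ) 0ℓ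

Above : (ℝ : Forcing) → Carrier ℝ → Subset ℝ
Above ℝ r s = _≤_ ℝ r s

IsOpen : (ℝ : Forcing) → Subset ℝ → Set
IsOpen ℝ D = ∀ s t → D s → _≤_ ℝ s t → D t

IsDense : (ℝ : Forcing) → Subset ℝ → Set
IsDense ℝ D = ∀ s → Σ[ t ∈ Carrier ℝ ] (_≤_ ℝ s t × D t)

IsDenseOpen : (ℝ : Forcing) → Subset ℝ → Set
IsDenseOpen ℝ D = IsDense ℝ D × IsOpen ℝ D

record IsProjection (ℙ ℚ : Forcing) (π : Carrier ℙ → Carrier ℚ) : Set where
  field
    monotone   : ∀ {p p'} → _≤_ ℙ p p' → _≤_ ℚ (π p) (π p')
    denseImage : ∀ q → Σ[ p ∈ Carrier ℙ ] _≤_ ℚ q (π p)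
    lift       : ∀ p q → _≤_ ℚ (π p) q →
                 Σ[ p' ∈ Carrier ℙ ] (_≤_ ℙ p p' × _≤_ ℚ q (π p'))

data Generated {X : Set} (G : Pred X 0ℓ → Set₁) : Pred X 0ℓ → Set₁ where
  gen : ∀ {A} → G A → Generated G A
  top : Generated G (λ _ → ⊤)
  cap : ∀ {A B} → Generated G A → Generated G B → Generated G (A ∩ B)
  sup : ∀ {A B} → Generated G A → A ⊆ B → Generated G B

DGen : (ℝ : Forcing) → Carrier ℝ → Subset ℝ → Set₁
DGen ℝ r A = Lift′ (IsDenseOpen ℝ A) ⊎ (A ≡ Above ℝ r)
  where
  open import Level using (Lift)
  Lift′ : Set → Set₁
  Lift′ S = Lift (Level.suc 0ℓ) S

D : (ℝ : Forcing) → Carrier ℝ → Subset ℝ → Set₁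
D ℝ r = Generated (DGen ℝ r)

record IsFilter {X : Set} (F : Pred X 0ℓ → Set) : Set₁ where
  field
    full   : F (λ _ → ⊤)
    proper : ¬ F (λ _ → ⊥)
    upward : ∀ {A B} → F A → A ⊆ B → F B
    inter  : ∀ {A B} → F A → F B → F (A ∩ B)

record IsUltrafilter {X : Set} (F : Pred X 0ℓ → Set) : Set₁ where
  field
    isFilter : IsFilter F
    ultra    : ∀ A → F A ⊎ F (∁ A)

-- Cardinals, represented by types (sets). |I| ≼ |K| iff there is an
-- injection I → K; |I| < |K| iff |I| ≼ |K| and not |K| ≼ |I|.

_≼_ : Set → Set → Set
I ≼ K = Σ[ f ∈ (I → K) ] Injective _≡_ _≡_ f

_≺_ : Set → Set → Set
I ≺ K = (I ≼ K) × ¬ (K ≼ I)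

IsRegularCardinal : Set → Set₁
IsRegularCardinal K =
  (ℕ ≼ K) ×
  (∀ (I : Set) (J : I → Set) → I ≺ K → (∀ i → J i ≺ K) → Σ I J ≺ K)

IsComplete : Set → {X : Set} → (Pred X 0ℓ → Set) → Set₁
IsComplete K {X} F =
  ∀ (I : Set) (A : I → Pred X 0ℓ) → I ≺ K → (∀ i → F (A i)) → F (⋂ I A)

Extends : {X : Set} → (Pred X 0ℓ → Set) → (Pred X 0ℓ → Set₁) → Set₁
Extends {X} F 𝒢 = ∀ (A : Pred X 0ℓ) → 𝒢 A → F A

HasCompleteUltrafilterExtending : Set → (ℝ : Forcing) → (Subset ℝ → Set₁) → Set₁
HasCompleteUltrafilterExtending K ℝ 𝒢 =
  Σ[ U ∈ (Subset ℝ → Set) ] (IsUltrafilter U × IsComplete K U × Extends U 𝒢)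

module Submission where

open import Defs
open import Level using (0ℓ; lift)
open import Data.Product using (_,_; proj₂)
open import Data.Sum using (inj₁; inj₂)
open import Relation.Unary using (Pred; _⊆_)
open import Relation.Binary.PropositionalEquality using (refl)

-- The pushforward π⁎ U of the ultrafilter U along π is an ultrafilter on ℚ with
-- the same completeness; the projection axioms make π⁻¹ of a dense open set dense
-- open, and π⁻¹ {q | q ≥ π p} ⊇ {p' | p' ≥ p}, so π⁎ U extends D_{π p}(ℚ).

pushforward : {X Y : Set} → (X → Y) → (Pred X 0ℓ → Set) → Pred Y 0ℓ → Set
pushforward f U B = U (λ x → B (f x))

module _ {X Y : Set} (f : X → Y) {U : Pred X 0ℓ → Set} where

  pushforward-isFilter : IsFilter U → IsFilter (pushforward f U)
  pushforward-isFilter isF = record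
    { full   = full
    ; proper = proper
    ; upward = λ fA A⊆B → upward fA A⊆B
    ; inter  = inter
    }
    where open IsFilter isF

  pushforward-isUltrafilter : IsUltrafilter U → IsUltrafilter (pushforward f U)
  pushforward-isUltrafilter isU = record
    { isFilter = pushforward-isFilter isFilter
    ; ultra    = λ B → ultra (λ x → B (f x))
    }
    where open IsUltrafilter isU

  pushforward-isComplete : ∀ {K} → IsComplete K U → IsComplete K (pushforward f U)
  pushforward-isComplete comp I B = comp I (λ i x → B i (f x))

module _ {ℙ ℚ : Forcing} {π : Carrier ℙ → Carrier ℚ} (proj : IsProjection ℙ ℚ π) where
  open IsProjection proj renaming (lift to lift-above)

  preimage-isOpen : ∀ {B} → IsOpen ℚ B → IsOpen ℙ (λ x → B (π x))
  preimage-isOpen open-B s t Bπs s≤t = open-B (π s) (π t) Bπs (monotone s≤t)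

  preimage-isDense : ∀ {B} → IsDenseOpen ℚ B → IsDense ℙ (λ x → B (π x))
  preimage-isDense (dense-B , open-B) s with dense-B (π s)
  ... | t , πs≤t , Bt with lift-above s t πs≤t
  ... | s' , s≤s' , t≤πs' = s' , s≤s' , open-B t (π s') Bt t≤πs'

  preimage-isDenseOpen : ∀ {B} → IsDenseOpen ℚ B → IsDenseOpen ℙ (λ x → B (π x))
  preimage-isDenseOpen B-do = preimage-isDense B-do , preimage-isOpen (proj₂ B-do)

  Above⊆preimage-Above : ∀ p → Above ℙ p ⊆ (λ x → Above ℚ (π p) (π x))
  Above⊆preimage-Above p = monotone

  pushforward-extends-D : ∀ {U} p → IsFilter U → Extends U (D ℙ p) →
                          Extends (pushforward π U) (D ℚ (π p))
  pushforward-extends-D {U} p isF ext = go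
    where
    open IsFilter isF
    go : Extends (pushforward π U) (D ℚ (π p))
    go B (gen (inj₁ (lift B-do))) = ext _ (gen (inj₁ (lift (preimage-isDenseOpen B-do))))
    go _ (gen (inj₂ refl))        = upward (ext _ (gen (inj₂ refl))) (Above⊆preimage-Above p)
    go _ top                      = full
    go _ (cap a b)                = inter (go _ a) (go _ b)
    go _ (sup a A⊆B)              = upward (go _ a) A⊆B

lemma4p1 : (ℙ ℚ : Forcing) (π : Carrier ℙ → Carrier ℚ) → IsProjection ℙ ℚ π →
    (K : Set) → IsRegularCardinal K → (p : Carrier ℙ) →
    HasCompleteUltrafilterExtending K ℙ (D ℙ p) →
    HasCompleteUltrafilterExtending K ℚ (D ℚ (π p))
lemma4p1 ℙ ℚ π proj K _ p (U , isU , comp , ext) =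
    pushforward π U
  , pushforward-isUltrafilter π isU
  , pushforward-isComplete π {U} comp
  , pushforward-extends-D proj p (IsUltrafilter.isFilter isU) ext
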